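{- For every premetric space $(X,d)$, the premetric space $(\widehat{X},\widehat{d})$ is complete. Consequently every premetric space $X$ admits a completion, and the completion is unique up to isometry: if $Y$ is a complete premetric space and $h:X\to Y$ is an isometric embedding with dense image, then there is an isometry (bijective isometric embedding) between $Y$ and $\widehat{X}$.
   Context: A premetric on a nonempty set $X$ is a relation $d$ between $X\times X$ and the nonnegative rationals, written $d(x,y)\leq q$, such that for all $x,y,z\in X$ and nonnegative rationals $p,q$: (1) $d(x,y)\leq 0$ iff $x=y$; (2) $d(x,y)\leq q$ implies $d(y,x)\leq q$; (3) $d(x,z)\leq p$ and $d(z,y)\leq q$ imply $d(x,y)\leq p+q$; (4) $d(x,y)\leq p$ iff $d(x,y)\leq q$ for all rationals $q>p$. For $S\subseteq X$, $\operatorname{diam} S\leq q$ means $d(x,y)\leq q$ for all $x,y\in S$. A Cauchy family on $X$ is $F\subseteq\mathcal{P}(X)$ with (i) $S\cap T\neq\emptyset$ for all $S,T\in F$ and (ii) for every rational $\varepsilon>0$ some $S\in F$ has $\operatorname{diam} S\leq\varepsilon$. For Cauchy families $F,F'$, $d(F,F')\leq q$ means: for every rational $\varepsilon>0$ there exist $S\in F$, $T\in F'$ with $\operatorname{diam} S,\operatorname{diam} T\leq\varepsilon$ and $\operatorname{diam}(S\cup T)\leq q+\varepsilon$. This is a pseudo-premetric; $F\sim F'$ iff $d(F,F')\leq 0$ is an equivalence relation; $\widehat{X}$ is the set of classes $[F]$ with premetric $\widehat{d}([F],[F'])\leq q$ iff $d(F,F')\leq q$. A premetric space $X$ is complete if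 the map $i:X\to\widehat{X}$, $i(x)=$ class of $\{\{x\}\}$, is onto. A map $f:(X,d_X)\to(Y,d_Y)$ is an isometric embedding if $d_X(x,x')\leq q\iff d_Y(f(x),f(x'))\leq q$ for all $x,x'$ and nonnegative rationals $q$; an isometry is an onto isometric embedding. $D\subseteq Y$ is dense if for every rational $\varepsilon>0$ and $y\in Y$ there is $z\in D$ with $d_Y(z,y)\leq\varepsilon$. A completion of $X$ is a complete premetric space $Y$ together with an isometric embedding $X\to Y$ with dense image. -}

module Defs where

open import Level using (Level; _⊔_) renaming (suc to lsuc)
open import Data.Rational using (ℚ; 0ℚ; _+_; _≤_; _<_)
open import Data.Product using (Σ; ∃; ∃-syntax; _×_)
open import Data.Sum using (_⊎_)
open import Function.Bundles using (_⇔_)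
open import Relation.Binary.Structures using (IsEquivalence)
open import Relation.Unary using (Pred)

-- Raw data of a (pre)metric space, presented as a setoid: a carrier,
-- an equality _≈_ (playing the role of "=" on X), and the relation
-- dist x y q  meaning  d(x,y) ≤ q.  Only nonnegative q are ever used.
record PSpace (a : Level) : Set (lsuc a) where
  field
    Carrier : Set a
    _≈_     : Carrier → Carrier → Set a
    dist    : Carrier → Carrier → ℚ → Set a

module _ {a : Level} (X : PSpace a) where
  open PSpace X

  record IsPremetric : Set a where
    field
      isEquivalence : IsEquivalence _≈_
      zero-iff : ∀ x y → dist x y 0ℚ ⇔ (x ≈ y)
      symm     : ∀ x y q → 0ℚ ≤ q → dist x y q → dist y x q
      triangle : ∀ x y z p q → 0ℚ ≤ p → 0ℚ ≤ q →
                 dist x z p → dist z y q → dist x y (p + q)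
      round    : ∀ x y p → 0ℚ ≤ p →
                 dist x y p ⇔ (∀ q → p < q → dist x y q)

  Diam : Pred Carrier a → ℚ → Set a
  Diam S q = ∀ x y → S x → S y → dist x y q

  _∪_ : Pred Carrier a → Pred Carrier a → Pred Carrier a
  (S ∪ T) x = S x ⊎ T x

  Meets : Pred Carrier a → Pred Carrier a → Set a
  Meets S T = ∃[ x ] ∃[ y ] (S x × T y × x ≈ y)

  Family : Set (lsuc a)
  Family = Pred (Pred Carrier a) a

  record CauchyFamily : Set (lsuc a) where
    field
      fam   : Family
      meets : ∀ S T → fam S → fam T → Meets S T
      small : ∀ ε → 0ℚ < ε → ∃[ S ] (fam S × Diam S ε)

  hatDist : Family → Family → ℚ → Set (lsuc a)
  hatDist F G q = ∀ ε → 0ℚ < ε →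
    ∃[ S ] ∃[ T ] (F S × G T × Diam S ε × Diam T ε × Diam (S ∪ T) (q + ε))

  -- The family {{x}}: its members are the subsets whose image in X is {x}.
  singletonFam : Carrier → Family
  singletonFam x S = (∃[ z ] S z) × (∀ z → S z → z ≈ x)

  -- X̂ : Cauchy families, with F ≈ F' iff d(F,F') ≤ 0 (the quotient by ~
  -- is presented as a setoid), and d̂([F],[F']) ≤ q iff d(F,F') ≤ q.
  Hat : PSpace (lsuc a)
  Hat = record
    { Carrier = CauchyFamily
    ; _≈_     = λ F G → hatDist (CauchyFamily.fam F) (CauchyFamily.fam G) 0ℚ
    ; dist    = λ F G q → hatDist (CauchyFamily.fam F) (CauchyFamily.fam G) q
    }

  -- X complete: i : X → X̂, x ↦ [{{x}}], is onto.
  IsComplete : Set (lsuc a)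
  IsComplete = ∀ (F : CauchyFamily) →
    ∃[ x ] hatDist (singletonFam x) (CauchyFamily.fam F) 0ℚ

module _ {a b : Level} (X : PSpace a) (Y : PSpace b) where
  private
    module X = PSpace X
    module Y = PSpace Y

  IsIsometricEmbedding : (X.Carrier → Y.Carrier) → Set (a ⊔ b)
  IsIsometricEmbedding f = ∀ x x' q → 0ℚ ≤ q →
    X.dist x x' q ⇔ Y.dist (f x) (f x') q

  IsOnto : (X.Carrier → Y.Carrier) → Set (a ⊔ b)
  IsOnto f = ∀ y → ∃[ x ] (f x Y.≈ y)

  IsIsometry : (X.Carrier → Y.Carrier) → Set (a ⊔ b)
  IsIsometry f = IsIsometricEmbedding f × IsOnto f

  HasDenseImage : (X.Carrier → Y.Carrier) → Set (a ⊔ b)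
  HasDenseImage f = ∀ ε → 0ℚ < ε → ∀ y → ∃[ x ] Y.dist (f x) y ε

  IsCompletion : (X.Carrier → Y.Carrier) → Set (a ⊔ lsuc b)
  IsCompletion h = IsPremetric Y × IsComplete Y ×
                   IsIsometricEmbedding h × HasDenseImage h

-- Every point F of X̂ is approximated by points of X: if S ∈ F has diameter ≤ ε and u ∈ S,
-- then d̂(ι u, F) ≤ ε.  Conversely a Cauchy net (x ε), d(x ε, x δ) ≤ ε/2 + δ/2, converges in
-- X̂ to the family of all supersets of the balls B(x ε, ε).  Given a Cauchy family 𝔉 on X̂,
-- pick members of 𝔉 of diameter ε/4 and approximate one of their points by some ι (x ε):
-- the x ε form a Cauchy net whose limit is the limit of 𝔉.  For a dense isometric embedding
-- h : X → Y, send y to the limit f y of a net with h (x ε) → y; then d(h x, y) ≤ r iff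
-- d̂(ι x, f y) ≤ r, which with density of h makes f isometric.  If Y is complete, a net in X
-- approximating F ∈ X̂ is carried by h to a net converging to some y₀, and f y₀ = F.

module Submission where

open import Defs
open import Level using (Level) renaming (suc to lsuc)
open import Data.Product using (Σ; _×_; _,_; proj₁; proj₂; ∃-syntax)
open import Data.Sum using (inj₁; inj₂)
open import Data.Rational using (ℚ; 0ℚ; _+_; _*_; _-_; -_; _≤_; _<_; ½)
import Data.Rational.Properties as ℚ
open import Data.Rational.Solver using (module +-*-Solver)
open +-*-Solver using (solve; _:+_; _:*_; _:-_; _:=_; con)
open import Data.Empty using (⊥-elim)
open import Function using (id)
open import Function.Bundles using (_⇔_; mk⇔; Equivalence)
open import Relation.Binary.PropositionalEquality using (_≡_; refl; sym; subst)
open import Relation.Binary.Structures using (IsEquivalence)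
open import Relation.Binary.Definitions using (tri<; tri≈; tri>)
open import Relation.Unary using (Pred; _⊆_)

half : ℚ → ℚ
half ε = ε * ½

quarter : ℚ → ℚ
quarter ε = half (half ε)

+-nonneg : ∀ {p q} → 0ℚ ≤ p → 0ℚ ≤ q → 0ℚ ≤ p + q
+-nonneg = ℚ.+-mono-≤

half-pos : ∀ {ε} → 0ℚ < ε → 0ℚ < half ε
half-pos {ε} ε>0 = subst (_< half ε) (ℚ.*-zeroˡ ½) (ℚ.*-monoˡ-<-pos ½ ε>0)

quarter-pos : ∀ {ε} → 0ℚ < ε → 0ℚ < quarter ε
quarter-pos ε>0 = half-pos (half-pos ε>0)

½ε+½ε≡ε : ∀ ε → half ε + half ε ≡ ε
½ε+½ε≡ε = solve 1 (λ ε → ε :* con ½ :+ ε :* con ½ := ε) refl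

≤-by-slack : ∀ {p q} s → 0ℚ ≤ s → p + s ≡ q → p ≤ q
≤-by-slack {p} s s≥0 refl = subst (_≤ p + s) (ℚ.+-identityʳ p) (ℚ.+-monoʳ-≤ p s≥0)

ε≤δ⇒½ε+½δ≤δ : ∀ {ε δ} → ε ≤ δ → half ε + half δ ≤ δ
ε≤δ⇒½ε+½δ≤δ {ε} {δ} ε≤δ = subst (half ε + half δ ≤_) (½ε+½ε≡ε δ)
  (ℚ.+-monoˡ-≤ (half δ) (ℚ.*-monoʳ-≤-nonNeg ½ ε≤δ))

half-nonneg : ∀ {ε} → 0ℚ ≤ ε → 0ℚ ≤ half ε
half-nonneg = ℚ.*-monoʳ-≤-nonNeg ½

½ε≤ε : ∀ {ε} → 0ℚ ≤ ε → half ε ≤ ε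
½ε≤ε {ε} ε≥0 = ≤-by-slack (half ε) (half-nonneg ε≥0) (½ε+½ε≡ε ε)

½ε+[½ε+q]≡q+ε : ∀ q ε → half ε + (half ε + q) ≡ q + ε
½ε+[½ε+q]≡q+ε = solve 2 (λ q ε → ε :* con ½ :+ (ε :* con ½ :+ q) := q :+ ε) refl

½ε+¼ε≤ε : ∀ {ε} → 0ℚ ≤ ε → half ε + quarter ε ≤ ε
½ε+¼ε≤ε {ε} ε≥0 = ≤-by-slack (quarter ε) (half-nonneg (half-nonneg ε≥0))
  (solve 1 (λ ε → (ε :* con ½ :+ ε :* con ½ :* con ½) :+ ε :* con ½ :* con ½ := ε) refl ε)

r+½ε+¼ε≤r+ε : ∀ r {ε} → 0ℚ ≤ ε → (r + half ε) + quarter ε ≤ r + ε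
r+½ε+¼ε≤r+ε r {ε} ε≥0 = subst (_≤ r + ε) (sym (ℚ.+-assoc r (half ε) (quarter ε)))
  (ℚ.+-monoʳ-≤ r (½ε+¼ε≤ε ε≥0))

r+¼ε+½ε≤r+ε : ∀ r {ε} → 0ℚ ≤ ε → (r + quarter ε) + half ε ≤ r + ε
r+¼ε+½ε≤r+ε r {ε} ε≥0 = subst (_≤ r + ε) (sym (ℚ.+-assoc r (quarter ε) (half ε)))
  (ℚ.+-monoʳ-≤ r (subst (_≤ ε) (ℚ.+-comm (half ε) (quarter ε)) (½ε+¼ε≤ε ε≥0)))

q≤p+q : ∀ {p q} → 0ℚ ≤ p → q ≤ p + q
q≤p+q {p} {q} p≥0 = ≤-by-slack p p≥0 (ℚ.+-comm q p)

p<q⇒0<q-p : ∀ {p q} → p < q → 0ℚ < q - p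
p<q⇒0<q-p {p} {q} p<q = subst (_< q - p) (ℚ.+-inverseʳ p) (ℚ.+-monoˡ-< (- p) p<q)

module Premetric {c : Level} (Z : PSpace c) (P : IsPremetric Z) where
  open PSpace Z
  open IsPremetric P
  open CauchyFamily
  private module ≈ = IsEquivalence isEquivalence

  -- d(x,y) ≤ q packaged with 0 ≤ q, the side condition of every premetric axiom.
  record Within (x y : Carrier) (q : ℚ) : Set c where
    constructor within
    field
      nonneg : 0ℚ ≤ q
      bound  : dist x y q

  open Within public

  within-pos : ∀ {x y ε} → 0ℚ < ε → dist x y ε → Within x y ε
  within-pos ε>0 = within (ℚ.<⇒≤ ε>0)

  ≈⇒within : ∀ {x y} → x ≈ y → Within x y 0ℚ
  ≈⇒within {x} {y} x≈y = within ℚ.≤-refl (Equivalence.from (zero-iff x y) x≈y)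

  within-sym : ∀ {x y q} → Within x y q → Within y x q
  within-sym {x} {y} {q} (within q≥0 d) = within q≥0 (symm x y q q≥0 d)

  within-trans : ∀ {x y z p q} → Within x y p → Within y z q → Within x z (p + q)
  within-trans {x} {y} {z} {p} {q} (within p≥0 d) (within q≥0 e) =
    within (+-nonneg p≥0 q≥0) (triangle x z y p q p≥0 q≥0 d e)

  within-weaken : ∀ {x y p q} → p ≤ q → Within x y p → Within x y q
  within-weaken {x} {y} {p} {q} p≤q (within p≥0 d) with ℚ.<-cmp p q
  ... | tri< p<q _ _ = within (ℚ.≤-trans p≥0 p≤q) (Equivalence.to (round x y p p≥0) d q p<q)
  ... | tri≈ _ refl _ = within p≥0 d
  ... | tri> _ _ q<p = ⊥-elim (ℚ.<-irrefl refl (ℚ.<-≤-trans q<p p≤q))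

  within-resp-≈ : ∀ {x x' y y' q} → x' ≈ x → y' ≈ y → Within x y q → Within x' y' q
  within-resp-≈ {q = q} x'≈x y'≈y w =
    subst (Within _ _) (solve 1 (λ q → con 0ℚ :+ (q :+ con 0ℚ) := q) refl q)
      (within-trans (≈⇒within x'≈x) (within-trans w (≈⇒within (≈.sym y'≈y))))

  within-respˡ-≈ : ∀ {x x' y q} → x' ≈ x → Within x y q → Within x' y q
  within-respˡ-≈ x'≈x = within-resp-≈ x'≈x ≈.refl

  within-closed : ∀ {x y q} → 0ℚ ≤ q → (∀ ε → 0ℚ < ε → Within x y (q + ε)) → Within x y q
  within-closed {x} {y} {q} q≥0 approx = within q≥0 (Equivalence.from (round x y q q≥0) λ q' q<q' →
    subst (dist x y) (solve 2 (λ q q' → q :+ (q' :- q) := q') refl q q')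
      (bound (approx (q' - q) (p<q⇒0<q-p q<q'))))

  within-zero : ∀ {x y} → (∀ ε → 0ℚ < ε → Within x y ε) → Within x y 0ℚ
  within-zero approx = within-closed ℚ.≤-refl λ ε ε>0 →
    subst (Within _ _) (sym (ℚ.+-identityˡ ε)) (approx ε ε>0)

  diam-weaken : ∀ {S p q} → 0ℚ ≤ p → p ≤ q → Diam Z S p → Diam Z S q
  diam-weaken p≥0 p≤q diamS x y Sx Sy = bound (within-weaken p≤q (within p≥0 (diamS x y Sx Sy)))

  ∪-diam : ∀ {S T r} → 0ℚ ≤ r → Diam Z S r → Diam Z T r →
           (∀ x y → S x → T y → dist x y r) → Diam Z (_∪_ Z S T) r
  ∪-diam r≥0 diamS diamT cross x y (inj₁ Sx) (inj₁ Sy) = diamS x y Sx Sy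
  ∪-diam r≥0 diamS diamT cross x y (inj₁ Sx) (inj₂ Ty) = cross x y Sx Ty
  ∪-diam r≥0 diamS diamT cross x y (inj₂ Tx) (inj₁ Sy) =
    bound (within-sym (within r≥0 (cross y x Sy Tx)))
  ∪-diam r≥0 diamS diamT cross x y (inj₂ Tx) (inj₂ Ty) = diamT x y Tx Ty

  ∪-diam-comm : ∀ {S T r} → Diam Z (_∪_ Z S T) r → Diam Z (_∪_ Z T S) r
  ∪-diam-comm diam x y (inj₁ Tx) (inj₁ Ty) = diam x y (inj₂ Tx) (inj₂ Ty)
  ∪-diam-comm diam x y (inj₁ Tx) (inj₂ Sy) = diam x y (inj₂ Tx) (inj₁ Sy)
  ∪-diam-comm diam x y (inj₂ Sx) (inj₁ Ty) = diam x y (inj₁ Sx) (inj₂ Ty)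
  ∪-diam-comm diam x y (inj₂ Sx) (inj₂ Sy) = diam x y (inj₁ Sx) (inj₁ Sy)

  hatDist-refl : ∀ (F : CauchyFamily Z) → hatDist Z (fam F) (fam F) 0ℚ
  hatDist-refl F ε ε>0 with small F ε ε>0
  ... | S , FS , diamS = S , S , FS , FS , diamS , diamS ,
    subst (Diam Z (_∪_ Z S S)) (sym (ℚ.+-identityˡ ε))
      (∪-diam (ℚ.<⇒≤ ε>0) diamS diamS diamS)

  hatDist-sym : ∀ {F G q} → hatDist Z F G q → hatDist Z G F q
  hatDist-sym F~G ε ε>0 with F~G ε ε>0
  ... | S , T , FS , GT , diamS , diamT , diamS∪T =
    T , S , GT , FS , diamT , diamS , ∪-diam-comm diamS∪T

  hatDist-weaken : ∀ {F G p q} → 0ℚ ≤ p → p ≤ q → hatDist Z F G p → hatDist Z F G q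
  hatDist-weaken p≥0 p≤q F~G ε ε>0 with F~G ε ε>0
  ... | S , T , FS , GT , diamS , diamT , diamS∪T = S , T , FS , GT , diamS , diamT ,
    diam-weaken (+-nonneg p≥0 (ℚ.<⇒≤ ε>0)) (ℚ.+-monoˡ-≤ ε p≤q) diamS∪T

  -- The two witnesses from the middle family H meet, which links S to U.
  hatDist-trans : ∀ {F G} (H : CauchyFamily Z) {p q} → 0ℚ ≤ p → 0ℚ ≤ q →
                  hatDist Z F (fam H) p → hatDist Z (fam H) G q → hatDist Z F G (p + q)
  hatDist-trans H {p} {q} p≥0 q≥0 F~H H~G ε ε>0
    with F~H (half ε) (half-pos ε>0) | H~G (half ε) (half-pos ε>0)
  ... | S , T , FS , HT , diamS , _ , diamS∪T | T' , U , HT' , GU , _ , diamU , diamT'∪U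
    with meets H T T' HT HT'
  ... | t , t' , Tt , T't' , t≈t' =
    S , U , FS , GU , diam-weaken ε/2≥0 ε/2≤ε diamS , diam-weaken ε/2≥0 ε/2≤ε diamU ,
    ∪-diam (+-nonneg (+-nonneg p≥0 q≥0) ε≥0)
      (diam-weaken ε/2≥0 ε/2≤p+q+ε diamS) (diam-weaken ε/2≥0 ε/2≤p+q+ε diamU) cross
    where
      ε≥0 = ℚ.<⇒≤ ε>0
      ε/2≥0 = half-nonneg ε≥0
      ε/2≤ε = ½ε≤ε ε≥0
      ε/2≤p+q+ε = ℚ.≤-trans ε/2≤ε (q≤p+q (+-nonneg p≥0 q≥0))
      cross : ∀ x y → S x → U y → dist x y ((p + q) + ε)
      cross x y Sx Uy = bound (subst (Within x y)
        (solve 3 (λ p q ε → (p :+ ε :* con ½) :+ (q :+ ε :* con ½) := (p :+ q) :+ ε) refl p q ε)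
        (within-trans (within (+-nonneg p≥0 ε/2≥0) (diamS∪T x t (inj₁ Sx) (inj₂ Tt)))
          (within-respˡ-≈ t≈t'
            (within (+-nonneg q≥0 ε/2≥0) (diamT'∪U t' y (inj₁ T't') (inj₂ Uy))))))

  hatDist-closed : ∀ {F G p} → 0ℚ ≤ p → (∀ q → p < q → hatDist Z F G q) → hatDist Z F G p
  hatDist-closed {p = p} p≥0 above ε ε>0
    with above (p + half ε) p<p+ε/2 (half ε) (half-pos ε>0)
    where p<p+ε/2 = subst (_< p + half ε) (ℚ.+-identityʳ p) (ℚ.+-monoʳ-< p (half-pos ε>0))
  ... | S , T , FS , GT , diamS , diamT , diamS∪T =
    S , T , FS , GT , diam-weaken ε/2≥0 (½ε≤ε ε≥0) diamS , diam-weaken ε/2≥0 (½ε≤ε ε≥0) diamT ,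
    subst (Diam Z (_∪_ Z S T))
      (solve 2 (λ p ε → (p :+ ε :* con ½) :+ ε :* con ½ := p :+ ε) refl p ε) diamS∪T
    where
      ε≥0 = ℚ.<⇒≤ ε>0
      ε/2≥0 = half-nonneg ε≥0

  Hat-isPremetric : IsPremetric (Hat Z)
  Hat-isPremetric = record
    { isEquivalence = record
      { refl  = λ {F} → hatDist-refl F
      ; sym   = hatDist-sym {q = 0ℚ}
      ; trans = λ {_} {G} F~G G~H → hatDist-trans G ℚ.≤-refl ℚ.≤-refl F~G G~H
      }
    ; zero-iff = λ F G → mk⇔ id id
    ; symm     = λ F G q q≥0 → hatDist-sym {q = q}
    ; triangle = λ F G H p q p≥0 q≥0 → hatDist-trans H p≥0 q≥0
    ; round    = λ F G p p≥0 → mk⇔ (λ F~G q p<q → hatDist-weaken p≥0 (ℚ.<⇒≤ p<q) F~G)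
                                   (hatDist-closed p≥0)
    }

  ≈-class : Carrier → Pred Carrier c
  ≈-class x z = z ≈ x

  ≈-class∈ι : ∀ x → singletonFam Z x (≈-class x)
  ≈-class∈ι x = (x , ≈.refl) , λ z z≈x → z≈x

  ≈-class-diam : ∀ x {r} → 0ℚ ≤ r → Diam Z (≈-class x) r
  ≈-class-diam x r≥0 z w z≈x w≈x =
    bound (within-weaken r≥0 (≈⇒within (≈.trans z≈x (≈.sym w≈x))))

  ι : Carrier → CauchyFamily Z
  ι x = record
    { fam   = singletonFam Z x
    ; meets = λ { S T ((s , Ss) , S⊆[x]) ((t , Tt) , T⊆[x]) →
                  s , t , Ss , Tt , ≈.trans (S⊆[x] s Ss) (≈.sym (T⊆[x] t Tt)) }
    ; small = λ ε ε>0 → ≈-class x , ≈-class∈ι x , ≈-class-diam x (ℚ.<⇒≤ ε>0)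
    }

  ι-isometric : IsIsometricEmbedding Z (Hat Z) ι
  ι-isometric x y q q≥0 = mk⇔ to from
    where
      to : dist x y q → hatDist Z (singletonFam Z x) (singletonFam Z y) q
      to d ε ε>0 = ≈-class x , ≈-class y , ≈-class∈ι x , ≈-class∈ι y ,
        ≈-class-diam x ε≥0 , ≈-class-diam y ε≥0 ,
        ∪-diam q+ε≥0 (≈-class-diam x q+ε≥0) (≈-class-diam y q+ε≥0) λ z w z≈x w≈y →
          bound (subst (Within z w) (ℚ.+-comm ε q)
            (within-weaken (q≤p+q ε≥0) (within-resp-≈ z≈x w≈y (within q≥0 d))))
        where
          ε≥0 = ℚ.<⇒≤ ε>0
          q+ε≥0 = +-nonneg q≥0 ε≥0
      from : hatDist Z (singletonFam Z x) (singletonFam Z y) q → dist x y q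
      from x~y = bound (within-closed q≥0 λ ε ε>0 → via-witnesses ε>0 (x~y ε ε>0))
        where
          via-witnesses : ∀ {ε} → 0ℚ < ε →
               ∃[ S ] ∃[ T ] (singletonFam Z x S × singletonFam Z y T × Diam Z S ε ×
                              Diam Z T ε × Diam Z (_∪_ Z S T) (q + ε)) →
               Within x y (q + ε)
          via-witnesses ε>0 (S , T , ((s , Ss) , S⊆[x]) , ((t , Tt) , T⊆[y]) , _ , _ , diamS∪T) =
            within-resp-≈ (≈.sym (S⊆[x] s Ss)) (≈.sym (T⊆[y] t Tt))
              (within (+-nonneg q≥0 (ℚ.<⇒≤ ε>0)) (diamS∪T s t (inj₁ Ss) (inj₂ Tt)))

  member-within⇒ι-within : ∀ (F : CauchyFamily Z) {S u r} → fam F S → 0ℚ ≤ r →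
                           (∀ z → S z → dist u z r) → hatDist Z (singletonFam Z u) (fam F) r
  member-within⇒ι-within F {S} {u} {r} FS r≥0 S-near-u ε ε>0 with small F ε ε>0
  ... | T , FT , diamT with meets F S T FS FT
  ... | s , t , Ss , Tt , s≈t =
    ≈-class u , T , ≈-class∈ι u , FT , ≈-class-diam u ε≥0 , diamT ,
    ∪-diam r+ε≥0 (≈-class-diam u r+ε≥0) (diam-weaken ε≥0 (q≤p+q r≥0) diamT) cross
    where
      ε≥0 = ℚ.<⇒≤ ε>0
      r+ε≥0 = +-nonneg r≥0 ε≥0
      cross : ∀ z w → z ≈ u → T w → dist z w (r + ε)
      cross z w z≈u Tw = bound (within-resp-≈ z≈u ≈.refl
        (within-trans (within r≥0 (S-near-u s Ss))
          (within-respˡ-≈ s≈t (within ε≥0 (diamT t w Tt Tw)))))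

  ι-dense : HasDenseImage Z (Hat Z) ι
  ι-dense ε ε>0 F with small F ε ε>0
  ... | S , FS , diamS with meets F S S FS FS
  ... | u , _ , Su , _ , _ =
    u , member-within⇒ι-within F FS (ℚ.<⇒≤ ε>0) (λ z Sz → diamS u z Su Sz)

  Net : Set c
  Net = (ε : ℚ) → 0ℚ < ε → Carrier

  IsCauchyNet : Net → Set c
  IsCauchyNet x = ∀ ε δ (ε>0 : 0ℚ < ε) (δ>0 : 0ℚ < δ) →
                  Within (x ε ε>0) (x δ δ>0) (half ε + half δ)

  module _ (x : Net) (cauchy : IsCauchyNet x) where

    ball : (ε : ℚ) → 0ℚ < ε → Pred Carrier c
    ball ε ε>0 z = dist (x ε ε>0) z ε

    center∈ball : ∀ {ε δ} (ε>0 : 0ℚ < ε) (δ>0 : 0ℚ < δ) → ε ≤ δ → ball δ δ>0 (x ε ε>0)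
    center∈ball {ε} {δ} ε>0 δ>0 ε≤δ = bound (within-weaken (ε≤δ⇒½ε+½δ≤δ ε≤δ)
      (subst (Within _ _) (ℚ.+-comm (half δ) (half ε)) (cauchy δ ε δ>0 ε>0)))

    netLimit : CauchyFamily Z
    netLimit = record { fam = ⊇-ball ; meets = ⊇-ball-meet ; small = ⊇-ball-small }
      where
        ⊇-ball : Family Z
        ⊇-ball S = Σ ℚ λ ε → Σ (0ℚ < ε) λ ε>0 → ball ε ε>0 ⊆ S

        ⊇-ball-meet : ∀ S T → ⊇-ball S → ⊇-ball T → Meets Z S T
        ⊇-ball-meet S T (ε , ε>0 , Bε⊆S) (δ , δ>0 , Bδ⊆T) with ℚ.≤-total ε δ
        ... | inj₁ ε≤δ = x ε ε>0 , x ε ε>0 ,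
          Bε⊆S (center∈ball ε>0 ε>0 ℚ.≤-refl) , Bδ⊆T (center∈ball ε>0 δ>0 ε≤δ) , ≈.refl
        ... | inj₂ δ≤ε = x δ δ>0 , x δ δ>0 ,
          Bε⊆S (center∈ball δ>0 ε>0 δ≤ε) , Bδ⊆T (center∈ball δ>0 δ>0 ℚ.≤-refl) , ≈.refl

        ⊇-ball-small : ∀ η → 0ℚ < η → ∃[ S ] (⊇-ball S × Diam Z S η)
        ⊇-ball-small η η>0 = ball (half η) η/2>0 , (half η , η/2>0 , id) , λ z w Bz Bw →
          bound (subst (Within z w) (½ε+½ε≡ε η)
            (within-trans (within-sym (within-pos η/2>0 Bz)) (within-pos η/2>0 Bw)))
          where η/2>0 = half-pos η>0

    netLimit-near : ∀ ε ε>0 → hatDist Z (singletonFam Z (x ε ε>0)) (fam netLimit) ε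
    netLimit-near ε ε>0 =
      member-within⇒ι-within netLimit (ε , ε>0 , id) (ℚ.<⇒≤ ε>0) λ z Bz → Bz

  complete⇒convergent : IsComplete Z → ∀ x → IsCauchyNet x →
                        ∃[ y ] ∀ ε ε>0 → Within (x ε ε>0) y ε
  complete⇒convergent complete x cauchy = y , λ ε ε>0 →
    within-pos ε>0 (Equivalence.from (ι-isometric (x ε ε>0) y ε (ℚ.<⇒≤ ε>0))
      (subst (hatDist Z _ _) (ℚ.+-identityʳ ε)
        (hatDist-trans (netLimit x cauchy) (ℚ.<⇒≤ ε>0) ℚ.≤-refl
          (netLimit-near x cauchy ε ε>0) (hatDist-sym {q = 0ℚ} ιy≈limit))))
    where
      y = proj₁ (complete (netLimit x cauchy))
      ιy≈limit = proj₂ (complete (netLimit x cauchy))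

compatible⇒isometric :
  ∀ {a b c} {X : PSpace a} (Y : PSpace b) (Z : PSpace c) → IsPremetric Y → IsPremetric Z →
  (h : PSpace.Carrier X → PSpace.Carrier Y) (g : PSpace.Carrier X → PSpace.Carrier Z) →
  HasDenseImage X Y h → (f : PSpace.Carrier Y → PSpace.Carrier Z) →
  (∀ x y r → 0ℚ ≤ r → PSpace.dist Y (h x) y r ⇔ PSpace.dist Z (g x) (f y) r) →
  IsIsometricEmbedding Y Z f
compatible⇒isometric Y Z PY PZ h g h-dense f compatible y y' q q≥0 = mk⇔ to from
  where
    module Y = Premetric Y PY
    module Z = Premetric Z PZ
    h→g : ∀ {x y r} → Y.Within (h x) y r → Z.Within (g x) (f y) r
    h→g {x} {y} {r} (Y.within r≥0 d) = Z.within r≥0 (Equivalence.to (compatible x y r r≥0) d)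
    g→h : ∀ {x y r} → Z.Within (g x) (f y) r → Y.Within (h x) y r
    g→h {x} {y} {r} (Z.within r≥0 d) = Y.within r≥0 (Equivalence.from (compatible x y r r≥0) d)
    h-near : ∀ ε → 0ℚ < ε → ∃[ x ] Y.Within (h x) y ε
    h-near ε ε>0 = let (x , hx~y) = h-dense ε ε>0 y in x , Y.within-pos ε>0 hx~y
    to : PSpace.dist Y y y' q → PSpace.dist Z (f y) (f y') q
    to d = Z.bound (Z.within-closed q≥0 λ ε ε>0 →
      let (x , hx~y) = h-near (half ε) (half-pos ε>0)
      in subst (Z.Within _ _) (½ε+[½ε+q]≡q+ε q ε)
           (Z.within-trans (Z.within-sym (h→g hx~y)) (h→g (Y.within-trans hx~y (Y.within q≥0 d)))))
    from : PSpace.dist Z (f y) (f y') q → PSpace.dist Y y y' q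
    from d = Y.bound (Y.within-closed q≥0 λ ε ε>0 →
      let (x , hx~y) = h-near (half ε) (half-pos ε>0)
      in subst (Y.Within _ _) (½ε+[½ε+q]≡q+ε q ε)
           (Y.within-trans (Y.within-sym hx~y) (g→h (Z.within-trans (h→g hx~y) (Z.within q≥0 d)))))

module Completion {a : Level} (X : PSpace a) (P : IsPremetric X) where
  open Premetric X P
  open CauchyFamily
  private
    module X̂ = Premetric (Hat X) Hat-isPremetric
    module X̂̂ = Premetric (Hat (Hat X)) X̂.Hat-isPremetric

  ι-preserves : ∀ {x y q} → Within x y q → X̂.Within (ι x) (ι y) q
  ι-preserves {x} {y} {q} (within q≥0 d) = X̂.within q≥0 (Equivalence.to (ι-isometric x y q q≥0) d)

  ι-reflects : ∀ {x y q} → X̂.Within (ι x) (ι y) q → Within x y q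
  ι-reflects {x} {y} {q} (X̂.within q≥0 d) = within q≥0 (Equivalence.from (ι-isometric x y q q≥0) d)

  module _ (𝔉 : CauchyFamily (Hat X)) where
    private
      small-member : ∀ ε → 0ℚ < ε → ∃[ 𝒮 ] (fam 𝔉 𝒮 × Diam (Hat X) 𝒮 (quarter ε))
      small-member ε ε>0 = small 𝔉 (quarter ε) (quarter-pos ε>0)

      𝒮 : (ε : ℚ) → 0ℚ < ε → Pred (CauchyFamily X) (lsuc a)
      𝒮 ε ε>0 = proj₁ (small-member ε ε>0)

      𝒮∈𝔉 : ∀ ε ε>0 → fam 𝔉 (𝒮 ε ε>0)
      𝒮∈𝔉 ε ε>0 = proj₁ (proj₂ (small-member ε ε>0))

      𝒮-diam : ∀ ε ε>0 → Diam (Hat X) (𝒮 ε ε>0) (quarter ε)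
      𝒮-diam ε ε>0 = proj₂ (proj₂ (small-member ε ε>0))

      F : (ε : ℚ) → 0ℚ < ε → CauchyFamily X
      F ε ε>0 = proj₁ (meets 𝔉 _ _ (𝒮∈𝔉 ε ε>0) (𝒮∈𝔉 ε ε>0))

      F∈𝒮 : ∀ ε ε>0 → 𝒮 ε ε>0 (F ε ε>0)
      F∈𝒮 ε ε>0 = proj₁ (proj₂ (proj₂ (meets 𝔉 _ _ (𝒮∈𝔉 ε ε>0) (𝒮∈𝔉 ε ε>0))))

      x : Net
      x ε ε>0 = proj₁ (ι-dense (quarter ε) (quarter-pos ε>0) (F ε ε>0))

    x-near-𝒮 : ∀ ε ε>0 K → 𝒮 ε ε>0 K → X̂.Within (ι (x ε ε>0)) K (half ε)
    x-near-𝒮 ε ε>0 K K∈𝒮 = subst (X̂.Within _ _) (½ε+½ε≡ε (half ε))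
      (X̂.within-trans
        (X̂.within-pos {y = F ε ε>0} ε/4>0 (proj₂ (ι-dense (quarter ε) ε/4>0 (F ε ε>0))))
        (X̂.within-pos ε/4>0 (𝒮-diam ε ε>0 _ K (F∈𝒮 ε ε>0) K∈𝒮)))
      where ε/4>0 = quarter-pos ε>0

    x-cauchy : IsCauchyNet x
    x-cauchy ε δ ε>0 δ>0 = through (meets 𝔉 _ _ (𝒮∈𝔉 ε ε>0) (𝒮∈𝔉 δ δ>0))
      where
        through : Meets (Hat X) (𝒮 ε ε>0) (𝒮 δ δ>0) →
                  Within (x ε ε>0) (x δ δ>0) (half ε + half δ)
        through (K , K' , K∈𝒮ε , K'∈𝒮δ , K≈K') = ι-reflects
          (X̂.within-trans (x-near-𝒮 ε ε>0 K K∈𝒮ε)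
            (X̂.within-respˡ-≈ K≈K' (X̂.within-sym (x-near-𝒮 δ δ>0 K' K'∈𝒮δ))))

    limit : CauchyFamily X
    limit = netLimit x x-cauchy

    limit-near-𝒮 : ∀ ε ε>0 K → 𝒮 ε ε>0 K → X̂.Within limit K (ε + half ε)
    limit-near-𝒮 ε ε>0 K K∈𝒮 = X̂.within-trans
      (X̂.within-sym (X̂.within-pos ε>0 (netLimit-near x x-cauchy ε ε>0)))
      (x-near-𝒮 ε ε>0 K K∈𝒮)

    ι-limit≈𝔉 : X̂̂.Within (X̂.ι limit) 𝔉 0ℚ
    ι-limit≈𝔉 = X̂̂.within-zero λ η η>0 → X̂̂.within-pos η>0
      (X̂.member-within⇒ι-within 𝔉 {u = limit} (𝒮∈𝔉 (half η) (half-pos η>0)) (ℚ.<⇒≤ η>0)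
        λ K K∈𝒮 → X̂.bound (X̂.within-weaken (½ε+¼ε≤ε (ℚ.<⇒≤ η>0))
          (limit-near-𝒮 (half η) (half-pos η>0) K K∈𝒮)))

  Hat-complete : IsComplete (Hat X)
  Hat-complete 𝔉 = limit 𝔉 , X̂̂.bound (ι-limit≈𝔉 𝔉)

  module Uniqueness {b : Level} (Y : PSpace b) (PY : IsPremetric Y) (Y-complete : IsComplete Y)
      (h : PSpace.Carrier X → PSpace.Carrier Y) (h-isometric : IsIsometricEmbedding X Y h)
      (h-dense : HasDenseImage X Y h) where
    private module Y = Premetric Y PY

    h-preserves : ∀ {x x' q} → Within x x' q → Y.Within (h x) (h x') q
    h-preserves {x} {x'} {q} (within q≥0 d) = Y.within q≥0 (Equivalence.to (h-isometric x x' q q≥0) d)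

    h-reflects : ∀ {x x' q} → Y.Within (h x) (h x') q → Within x x' q
    h-reflects {x} {x'} {q} (Y.within q≥0 d) = within q≥0 (Equivalence.from (h-isometric x x' q q≥0) d)

    approx : PSpace.Carrier Y → Net
    approx y ε ε>0 = proj₁ (h-dense (half ε) (half-pos ε>0) y)

    h-approx : ∀ y ε ε>0 → Y.Within (h (approx y ε ε>0)) y (half ε)
    h-approx y ε ε>0 = Y.within-pos (half-pos ε>0) (proj₂ (h-dense (half ε) (half-pos ε>0) y))

    approx-cauchy : ∀ y → IsCauchyNet (approx y)
    approx-cauchy y ε δ ε>0 δ>0 =
      h-reflects (Y.within-trans (h-approx y ε ε>0) (Y.within-sym (h-approx y δ δ>0)))

    f : PSpace.Carrier Y → CauchyFamily X
    f y = netLimit (approx y) (approx-cauchy y)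

    ι-approx-near-f : ∀ y ε ε>0 → X̂.Within (ι (approx y ε ε>0)) (f y) ε
    ι-approx-near-f y ε ε>0 = X̂.within-pos ε>0 (netLimit-near (approx y) (approx-cauchy y) ε ε>0)

    f-compatible : ∀ x y r → 0ℚ ≤ r →
                   PSpace.dist Y (h x) y r ⇔ PSpace.dist (Hat X) (ι x) (f y) r
    f-compatible x y r r≥0 = mk⇔ to from
      where
        to : PSpace.dist Y (h x) y r → PSpace.dist (Hat X) (ι x) (f y) r
        to d = X̂.bound (X̂.within-closed r≥0 λ ε ε>0 →
          let ε/2>0 = half-pos ε>0 in
          X̂.within-weaken (r+¼ε+½ε≤r+ε r (ℚ.<⇒≤ ε>0))
            (X̂.within-trans
              (ι-preserves (h-reflects (Y.within-trans (Y.within r≥0 d)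
                (Y.within-sym (h-approx y (half ε) ε/2>0)))))
              (ι-approx-near-f y (half ε) ε/2>0)))
        from : PSpace.dist (Hat X) (ι x) (f y) r → PSpace.dist Y (h x) y r
        from d̂ = Y.bound (Y.within-closed r≥0 λ ε ε>0 →
          let ε/2>0 = half-pos ε>0 in
          Y.within-weaken (r+½ε+¼ε≤r+ε r (ℚ.<⇒≤ ε>0))
            (Y.within-trans
              (h-preserves (ι-reflects (X̂.within-trans (X̂.within {x = ι x} r≥0 d̂)
                (X̂.within-sym (ι-approx-near-f y (half ε) ε/2>0)))))
              (h-approx y (half ε) ε/2>0)))

    f-isometric : IsIsometricEmbedding Y (Hat X) f
    f-isometric =
      compatible⇒isometric {X = X} Y (Hat X) PY Hat-isPremetric h ι h-dense f f-compatible

    f-onto : IsOnto Y (Hat X) f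
    f-onto F = y₀ , X̂.bound (X̂.within-zero λ ε ε>0 →
      X̂.within-weaken (½ε+¼ε≤ε (ℚ.<⇒≤ ε>0))
        (X̂.within-trans (X̂.within-sym (ιz-near-fy₀ (half ε) (half-pos ε>0)))
          (ιz-near-F (half ε) (half-pos ε>0))))
      where
        z : Net
        z ε ε>0 = proj₁ (ι-dense (half ε) (half-pos ε>0) F)

        ιz-near-F : ∀ ε ε>0 → X̂.Within (ι (z ε ε>0)) F (half ε)
        ιz-near-F ε ε>0 = X̂.within-pos (half-pos ε>0) (proj₂ (ι-dense (half ε) (half-pos ε>0) F))

        z-cauchy : IsCauchyNet z
        z-cauchy ε δ ε>0 δ>0 =
          ι-reflects (X̂.within-trans (ιz-near-F ε ε>0) (X̂.within-sym (ιz-near-F δ δ>0)))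

        hz-cauchy : Y.IsCauchyNet (λ ε ε>0 → h (z ε ε>0))
        hz-cauchy ε δ ε>0 δ>0 = h-preserves (z-cauchy ε δ ε>0 δ>0)

        y₀ : PSpace.Carrier Y
        y₀ = proj₁ (Y.complete⇒convergent Y-complete _ hz-cauchy)

        ιz-near-fy₀ : ∀ ε ε>0 → X̂.Within (ι (z ε ε>0)) (f y₀) ε
        ιz-near-fy₀ ε ε>0 = X̂.within ε≥0 (Equivalence.to (f-compatible (z ε ε>0) y₀ ε ε≥0)
          (Y.bound (proj₂ (Y.complete⇒convergent Y-complete _ hz-cauchy) ε ε>0)))
          where ε≥0 = ℚ.<⇒≤ ε>0

theorem3p3 : ∀ {a b : Level} (X : PSpace a) → IsPremetric X →
    (IsPremetric (Hat X) × IsComplete (Hat X))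
    × Σ (PSpace (lsuc a)) (λ Y →
        Σ (PSpace.Carrier X → PSpace.Carrier Y) (λ h → IsCompletion X Y h))
    × (∀ (Y : PSpace b) → IsPremetric Y → IsComplete Y →
        (h : PSpace.Carrier X → PSpace.Carrier Y) →
        IsIsometricEmbedding X Y h → HasDenseImage X Y h →
        Σ (PSpace.Carrier Y → PSpace.Carrier (Hat X))
          (λ f → IsIsometry Y (Hat X) f))
theorem3p3 X P =
  (Hat-isPremetric , Hat-complete) ,
  (Hat X , ι , Hat-isPremetric , Hat-complete , ι-isometric , ι-dense) ,
  λ Y PY Y-complete h h-isometric h-dense →
    let open Uniqueness Y PY Y-complete h h-isometric h-dense in f , f-isometric , f-onto
  where
    open Premetric X P
    open Completion X P
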